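{- Let $n\ge 2$. The term rewriting system $\rightarrowtail_{\mathrm{hnf}}$ on $\nu_n$-terms, given by the rules $(h_0)$ $q(\mathsf e_i,x_1,\dots,x_n)\rightarrowtail x_i$ (for each $1\le i\le n$) and $(h_1)$ $q(q(x,y_1,\dots,y_n),z_1,\dots,z_n)\rightarrowtail q(x,q(y_1,z_1,\dots,z_n),\dots,q(y_n,z_1,\dots,z_n))$, is terminating and confluent.
   Context: $\nu_n$ is the type with one $(n+1)$-ary function symbol $q$ and constants $\mathsf e_1,\dots,\mathsf e_n$; terms are built over a countable set of variables. In the rules, $x,x_i,y_i,z_j$ are variables of the rule schemes, to be instantiated by arbitrary terms, and rules may be applied to any subterm. Terminating means there is no infinite rewrite sequence; confluent means that any two terms reachable by rewriting from a common term can be rewritten to a common term. -}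

module Defs where

open import Data.Nat using (ℕ)
open import Data.Fin using (Fin)
open import Data.Vec using (Vec; lookup; map)
open import Data.Product using (∃; _×_)
open import Relation.Binary.Construct.Closure.ReflexiveTransitive using (Star)
open import Induction.WellFounded using (WellFounded)
open import Function using (flip)

-- ν_n-terms over the countable variable set ℕ:
-- one (n+1)-ary symbol q (head argument + n further arguments) and constants e_1..e_n
-- (indexed by Fin n, i.e. e_(i+1) is `e i`).
data Term (n : ℕ) : Set where
  var : ℕ → Term n
  e   : Fin n → Term n
  q   : Term n → Vec (Term n) n → Term n

infix 4 _⟶_
data _⟶_ {n : ℕ} : Term n → Term n → Set
data ArgStep {n : ℕ} : {k : ℕ} → Vec (Term n) k → Vec (Term n) k → Set

data _⟶_ {n} where
  h0 : (i : Fin n) (xs : Vec (Term n) n) → q (e i) xs ⟶ lookup xs i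
  h1 : (x : Term n) (ys zs : Vec (Term n) n) →
       q (q x ys) zs ⟶ q x (map (λ y → q y zs) ys)
  head : {s t : Term n} (xs : Vec (Term n) n) → s ⟶ t → q s xs ⟶ q t xs
  arg  : (s : Term n) {xs ys : Vec (Term n) n} → ArgStep xs ys → q s xs ⟶ q s ys

data ArgStep {n} where
  here  : {k : ℕ} {s t : Term n} (xs : Vec (Term n) k) → s ⟶ t →
          ArgStep (s Data.Vec.∷ xs) (t Data.Vec.∷ xs)
  there : {k : ℕ} (s : Term n) {xs ys : Vec (Term n) k} → ArgStep xs ys →
          ArgStep (s Data.Vec.∷ xs) (s Data.Vec.∷ ys)

_⟶*_ : {n : ℕ} → Term n → Term n → Set
_⟶*_ = Star _⟶_

-- terminating: no infinite rewrite sequence, stated constructively as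
-- well-foundedness of the converse step relation
Terminating : ℕ → Set
Terminating n = WellFounded (flip (_⟶_ {n}))

Confluent : ℕ → Set
Confluent n = {s t u : Term n} → s ⟶* t → s ⟶* u → ∃ λ v → (t ⟶* v) × (u ⟶* v)

module Submission where

-- Define an evaluation `eval : Term n → Term n` by structural
-- recursion, using an operation `t ∙ zs` which computes the normal form of
-- q(t, zs) from normal forms t and zs: it replaces the constants e_i on the
-- head spine of t by z_i.  Then (a) every term rewrites to its evaluation,
-- and (b) one rewrite step does not change the evaluation; (b) for (h1) is
-- exactly associativity (t ∙ ys) ∙ zs ≡ t ∙ (ys ∙* zs).  An abstract lemma
-- turns (a) and (b) into confluence: two reducts of s both reach eval s.
--
-- Interpret terms in ℕ by ⟦var⟧ = ⟦e_i⟧ = 1 and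
-- ⟦q(s, x⃗)⟧ = ⟦s⟧ · (2 + Σ ⟦x_i⟧).  Every step strictly decreases the
-- weight (the interpretation is monotone, and for (h1) it reduces to
-- 2 + Y·m < (2 + Y)·m for m ≥ 2), so the converse step relation is a
-- subrelation of the inverse image of < on ℕ and hence well-founded.
--
-- Neither argument needs n ≥ 2: the system is convergent for every n.

open import Defs
open import Data.Nat using (ℕ; _≤_)
open import Data.Product using (_×_)

open import Data.Nat using (_+_; _*_; _<_; z≤n; s≤s; >-nonZero)
open import Data.Nat.Properties
open import Data.Nat.Induction using (<-wellFounded)
open import Data.Fin using (Fin)
import Data.Fin as Fin
open import Data.Vec using (Vec; []; _∷_; lookup; map)
open import Data.Product using (_,_)
open import Function using (flip)
open import Induction.WellFounded using (WellFounded; module Subrelation)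
import Relation.Binary.Construct.On as On
open import Relation.Binary.Construct.Closure.ReflexiveTransitive
  using (Star; ε; _◅_; _◅◅_; gmap)
open import Relation.Binary.PropositionalEquality
  using (_≡_; refl; cong; cong₂; sym; trans; subst; module ≡-Reasoning)

module Joinable {A : Set} (_⇒_ : A → A → Set) (nf : A → A)
                (reaches : (x : A) → Star _⇒_ x (nf x))
                (preserves : {x y : A} → x ⇒ y → nf x ≡ nf y) where

  preserves* : {x y : A} → Star _⇒_ x y → nf x ≡ nf y
  preserves* ε        = refl
  preserves* (r ◅ rs) = trans (preserves r) (preserves* rs)

  joinable : {s t u : A} → Star _⇒_ s t → Star _⇒_ s u →
             Star _⇒_ t (nf s) × Star _⇒_ u (nf s)
  joinable {t = t} {u} st su =
    subst (Star _⇒_ t) (sym (preserves* st)) (reaches t) ,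
    subst (Star _⇒_ u) (sym (preserves* su)) (reaches u)

decreasing⇒wellFounded : {A : Set} {_⇒_ : A → A → Set} (w : A → ℕ) →
                         ({x y : A} → x ⇒ y → w y < w x) →
                         WellFounded (flip _⇒_)
decreasing⇒wellFounded w dec =
  Subrelation.wellFounded dec (On.wellFounded w <-wellFounded)

module _ {n : ℕ} where

  Args : ℕ → Set
  Args k = Vec (Term n) k

  head* : {s t : Term n} (xs : Args n) → s ⟶* t → q s xs ⟶* q t xs
  head* xs = gmap (λ s → q s xs) (head xs)

  args* : (s : Term n) {xs ys : Args n} → Star ArgStep xs ys → q s xs ⟶* q s ys
  args* s = gmap (q s) (arg s)

  here* : ∀ {k} {x y : Term n} (xs : Args k) → x ⟶* y → Star ArgStep (x ∷ xs) (y ∷ xs)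
  here* xs = gmap (_∷ xs) (here xs)

  there* : ∀ {k} (x : Term n) {xs ys : Args k} → Star ArgStep xs ys →
           Star ArgStep (x ∷ xs) (x ∷ ys)
  there* x = gmap (x ∷_) (there x)

  -- `t ∙ zs` is the normal form of q(t, zs) when t and zs are normal:
  -- constants e_i on the head spine of t are replaced by z_i.
  infixl 25 _∙_ _∙*_
  mutual
    _∙_ : Term n → Args n → Term n
    var k  ∙ zs = q (var k) zs
    e i    ∙ zs = lookup zs i
    q h ws ∙ zs = q h (ws ∙* zs)

    _∙*_ : ∀ {k} → Args k → Args n → Args k
    []       ∙* zs = []
    (w ∷ ws) ∙* zs = w ∙ zs ∷ ws ∙* zs

  lookup-∙* : ∀ {k} (ys : Args k) (zs : Args n) (i : Fin k) →
              lookup ys i ∙ zs ≡ lookup (ys ∙* zs) i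
  lookup-∙* (y ∷ ys) zs Fin.zero    = refl
  lookup-∙* (y ∷ ys) zs (Fin.suc i) = lookup-∙* ys zs i

  -- Associativity of `∙`: the semantic content of rule (h1).
  mutual
    ∙-assoc : (t : Term n) (ys zs : Args n) → t ∙ ys ∙ zs ≡ t ∙ (ys ∙* zs)
    ∙-assoc (var k)  ys zs = refl
    ∙-assoc (e i)    ys zs = lookup-∙* ys zs i
    ∙-assoc (q h ws) ys zs = cong (q h) (∙*-assoc ws ys zs)

    ∙*-assoc : ∀ {k} (ws : Args k) (ys zs : Args n) → ws ∙* ys ∙* zs ≡ ws ∙* (ys ∙* zs)
    ∙*-assoc []       ys zs = refl
    ∙*-assoc (w ∷ ws) ys zs = cong₂ _∷_ (∙-assoc w ys zs) (∙*-assoc ws ys zs)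

  mutual
    q⟶*∙ : (t : Term n) (zs : Args n) → q t zs ⟶* t ∙ zs
    q⟶*∙ (var k)  zs = ε
    q⟶*∙ (e i)    zs = h0 i zs ◅ ε
    q⟶*∙ (q h ws) zs = h1 h ws zs ◅ args* h (q⟶*∙* ws zs)

    q⟶*∙* : ∀ {k} (ws : Args k) (zs : Args n) →
            Star ArgStep (map (λ w → q w zs) ws) (ws ∙* zs)
    q⟶*∙* []       zs = ε
    q⟶*∙* (w ∷ ws) zs = here* _ (q⟶*∙ w zs) ◅◅ there* (w ∙ zs) (q⟶*∙* ws zs)

  mutual
    eval : Term n → Term n
    eval (var k)  = var k
    eval (e i)    = e i
    eval (q s zs) = eval s ∙ eval* zs

    eval* : ∀ {k} → Args k → Args k
    eval* []       = []
    eval* (x ∷ xs) = eval x ∷ eval* xs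

  mutual
    ⟶*eval : (t : Term n) → t ⟶* eval t
    ⟶*eval (var k)  = ε
    ⟶*eval (e i)    = ε
    ⟶*eval (q s zs) =
      head* zs (⟶*eval s) ◅◅ args* (eval s) (⟶*eval* zs) ◅◅ q⟶*∙ (eval s) (eval* zs)

    ⟶*eval* : ∀ {k} (zs : Args k) → Star ArgStep zs (eval* zs)
    ⟶*eval* []       = ε
    ⟶*eval* (z ∷ zs) = here* zs (⟶*eval z) ◅◅ there* (eval z) (⟶*eval* zs)

  lookup-eval* : ∀ {k} (xs : Args k) (i : Fin k) → lookup (eval* xs) i ≡ eval (lookup xs i)
  lookup-eval* (x ∷ xs) Fin.zero    = refl
  lookup-eval* (x ∷ xs) (Fin.suc i) = lookup-eval* xs i

  eval*-map-q : ∀ {k} (ys : Args k) (zs : Args n) →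
                eval* (map (λ y → q y zs) ys) ≡ eval* ys ∙* eval* zs
  eval*-map-q []       zs = refl
  eval*-map-q (y ∷ ys) zs = cong (eval y ∙ eval* zs ∷_) (eval*-map-q ys zs)

  mutual
    eval-preserved : {s t : Term n} → s ⟶ t → eval s ≡ eval t
    eval-preserved (h0 i xs)    = lookup-eval* xs i
    eval-preserved (h1 x ys zs) = begin
      eval x ∙ eval* ys ∙ eval* zs                ≡⟨ ∙-assoc (eval x) (eval* ys) (eval* zs) ⟩
      eval x ∙ (eval* ys ∙* eval* zs)             ≡⟨ cong (eval x ∙_) (sym (eval*-map-q ys zs)) ⟩
      eval x ∙ eval* (map (λ y → q y zs) ys)      ∎
      where open ≡-Reasoning
    eval-preserved (head xs r)  = cong (_∙ eval* xs) (eval-preserved r)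
    eval-preserved (arg s r)    = cong (eval s ∙_) (eval*-preserved r)

    eval*-preserved : ∀ {k} {xs ys : Args k} → ArgStep xs ys → eval* xs ≡ eval* ys
    eval*-preserved (here xs r)  = cong (_∷ eval* xs) (eval-preserved r)
    eval*-preserved (there s r)  = cong (eval s ∷_) (eval*-preserved r)

  confluent : Confluent n
  confluent {s} st su = eval s , joinable st su
    where open Joinable _⟶_ eval ⟶*eval eval-preserved

  mutual
    ⟦_⟧ : Term n → ℕ
    ⟦ var k ⟧  = 1
    ⟦ e i ⟧    = 1
    ⟦ q s xs ⟧ = ⟦ s ⟧ * (2 + Σ xs)

    Σ : ∀ {k} → Args k → ℕ
    Σ []       = 0
    Σ (x ∷ xs) = ⟦ x ⟧ + Σ xs

  -- Weights are positive, so multiplying by ⟦ s ⟧ is strictly monotone.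
  ⟦⟧-positive : (t : Term n) → 0 < ⟦ t ⟧
  ⟦⟧-positive (var k)  = s≤s z≤n
  ⟦⟧-positive (e i)    = s≤s z≤n
  ⟦⟧-positive (q s xs) = ≤-trans (⟦⟧-positive s) (m≤m*n ⟦ s ⟧ (2 + Σ xs))

  lookup≤Σ : ∀ {k} (xs : Args k) (i : Fin k) → ⟦ lookup xs i ⟧ ≤ Σ xs
  lookup≤Σ (x ∷ xs) Fin.zero    = m≤m+n _ _
  lookup≤Σ (x ∷ xs) (Fin.suc i) = ≤-trans (lookup≤Σ xs i) (m≤n+m _ _)

  Σ-map-q : ∀ {k} (ys : Args k) (zs : Args n) →
            Σ (map (λ y → q y zs) ys) ≡ Σ ys * (2 + Σ zs)
  Σ-map-q []       zs = refl
  Σ-map-q (y ∷ ys) zs = begin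
    ⟦ y ⟧ * (2 + Σ zs) + Σ (map (λ y → q y zs) ys) ≡⟨ cong (⟦ y ⟧ * (2 + Σ zs) +_) (Σ-map-q ys zs) ⟩
    ⟦ y ⟧ * (2 + Σ zs) + Σ ys * (2 + Σ zs)         ≡⟨ *-distribʳ-+ (2 + Σ zs) ⟦ y ⟧ (Σ ys) ⟨
    (⟦ y ⟧ + Σ ys) * (2 + Σ zs)                    ∎
    where open ≡-Reasoning

  h1-inequality : (Y m : ℕ) → 2 ≤ m → 2 + Y * m < (2 + Y) * m
  h1-inequality Y m 2≤m = begin-strict
    2 + Y * m     <⟨ +-monoˡ-< (Y * m) 2<2m ⟩
    2 * m + Y * m ≡⟨ *-distribʳ-+ m 2 Y ⟨
    (2 + Y) * m   ∎
    where open ≤-Reasoning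
          2<2m : 2 < 2 * m
          2<2m = ≤-trans (n≤1+n 3) (*-monoʳ-≤ 2 2≤m)

  mutual
    ⟦⟧-decreasing : {s t : Term n} → s ⟶ t → ⟦ t ⟧ < ⟦ s ⟧
    ⟦⟧-decreasing (h0 i xs) = s≤s (≤-trans (lookup≤Σ xs i) (≤-trans (n≤1+n _) (m≤m+n _ 0)))
    ⟦⟧-decreasing (h1 x ys zs) = begin-strict
      ⟦ x ⟧ * (2 + Σ (map (λ y → q y zs) ys)) ≡⟨ cong (λ w → ⟦ x ⟧ * (2 + w)) (Σ-map-q ys zs) ⟩
      ⟦ x ⟧ * (2 + Σ ys * (2 + Σ zs))         <⟨ *-monoʳ-< ⟦ x ⟧ (h1-inequality (Σ ys) _ (s≤s (s≤s z≤n))) ⟩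
      ⟦ x ⟧ * ((2 + Σ ys) * (2 + Σ zs))       ≡⟨ *-assoc ⟦ x ⟧ _ _ ⟨
      ⟦ x ⟧ * (2 + Σ ys) * (2 + Σ zs)         ∎
      where open ≤-Reasoning
            instance _ = >-nonZero (⟦⟧-positive x)
    ⟦⟧-decreasing (head xs r) = *-monoˡ-< (2 + Σ xs) (⟦⟧-decreasing r)
    ⟦⟧-decreasing (arg s r)   = *-monoʳ-< ⟦ s ⟧ (s≤s (s≤s (Σ-decreasing r)))
      where instance _ = >-nonZero (⟦⟧-positive s)

    Σ-decreasing : ∀ {k} {xs ys : Args k} → ArgStep xs ys → Σ ys < Σ xs
    Σ-decreasing (here xs r)  = +-monoˡ-< (Σ xs) (⟦⟧-decreasing r)
    Σ-decreasing (there s r)  = +-monoʳ-< ⟦ s ⟧ (Σ-decreasing r)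

  terminating : Terminating n
  terminating = decreasing⇒wellFounded ⟦_⟧ ⟦⟧-decreasing

theorem7p9 : (n : ℕ) → 2 ≤ n → Terminating n × Confluent n
theorem7p9 n _ = terminating , confluent
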